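{- There are infinitely many 2-strong split digraphs which do not have a strong arc decomposition.
   Context: Digraphs have no loops and no parallel arcs. A digraph is semicomplete if every two distinct vertices are joined by at least one arc. A split digraph is a digraph whose vertex set is the disjoint union of two non-empty sets $V_1,V_2$ such that $V_1$ is independent and the subdigraph induced by $V_2$ is semicomplete. A digraph is strong if there is a directed path between every ordered pair of distinct vertices; it is 2-strong if it has at least three vertices and remains strong after deleting any single vertex. A strong arc decomposition of $D=(V,A)$ is a partition of $A$ into two disjoint sets $A_1,A_2$ such that both spanning subdigraphs $(V,A_1)$ and $(V,A_2)$ are strong. -}

module Defs where

open import Data.Nat using (ℕ; suc; _≤_)
open import Data.Fin using (Fin; punchIn)
open import Data.Bool using (Bool; true; false; _∨_; _∧_)
open import Data.Product using (Σ; ∃; _×_)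
open import Data.Sum using (_⊎_)
open import Data.Unit using (⊤)
open import Relation.Binary.PropositionalEquality using (_≡_; _≢_)
open import Relation.Binary.Construct.Closure.ReflexiveTransitive using (Star)

record Digraph (n : ℕ) : Set where
  field
    arc      : Fin n → Fin n → Bool
    loopless : ∀ i → arc i i ≡ false
open Digraph public

-- Reachability along arcs of an arc set R (a directed walk; a walk between
-- distinct vertices contains a directed path).
Reach : {n : ℕ} → (Fin n → Fin n → Bool) → Fin n → Fin n → Set
Reach R = Star (λ u v → R u v ≡ true)

StrongArcs : {n : ℕ} → (Fin n → Fin n → Bool) → Set
StrongArcs {n} R = ∀ (u v : Fin n) → u ≢ v → Reach R u v

Strong : {n : ℕ} → Digraph n → Set
Strong D = StrongArcs (arc D)

deleteVertex : {m : ℕ} → Digraph (suc m) → Fin (suc m) → Digraph m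
deleteVertex D x = record
  { arc      = λ i j → arc D (punchIn x i) (punchIn x j)
  ; loopless = λ i → loopless D (punchIn x i) }

AllDeletionsStrong : {n : ℕ} → Digraph n → Set
AllDeletionsStrong {ℕ.zero}  D = ⊤
AllDeletionsStrong {suc m} D = ∀ (x : Fin (suc m)) → Strong (deleteVertex D x)

TwoStrong : {n : ℕ} → Digraph n → Set
TwoStrong {n} D = 3 ≤ n × AllDeletionsStrong D

Split : {n : ℕ} → Digraph n → Set
Split {n} D = Σ (Fin n → Bool) λ inV₁ →
    (∃ λ u → inV₁ u ≡ true)
  × (∃ λ u → inV₁ u ≡ false)
  × (∀ u v → inV₁ u ≡ true → inV₁ v ≡ true → arc D u v ≡ false)
  × (∀ u v → inV₁ u ≡ false → inV₁ v ≡ false → u ≢ v →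
       (arc D u v ≡ true) ⊎ (arc D v u ≡ true))

HasStrongArcDecomposition : {n : ℕ} → Digraph n → Set
HasStrongArcDecomposition {n} D =
  Σ (Fin n → Fin n → Bool) λ A₁ → Σ (Fin n → Fin n → Bool) λ A₂ →
      (∀ u v → (A₁ u v ∨ A₂ u v) ≡ arc D u v)
    × (∀ u v → (A₁ u v ∧ A₂ u v) ≡ false)
    × StrongArcs A₁
    × StrongArcs A₂

-- Take a complete digraph C containing x and z, vertices t₁ → t₂ both dominating C, and
-- a vertex y with t₂ → y → t₁, t₂, plus the arcs x → t₁ and z → y; then V₁ = {y}.
-- Deleting any v ≠ x leaves every vertex reaching x and reachable from x; deleting x,
-- the same holds for z. Each of five vertex sets is left
-- by exactly two arcs, and each strong spanning subdigraph must use one of them, so a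
-- strong arc decomposition puts the two in different parts. The five pairs link the
-- arcs xt₁, yt₁, yt₂, t₁t₂, zy in an odd cycle, which admits no such 2-colouring.
module Submission where

open import Defs
open import Data.Nat using (ℕ; _≤_; _+_; s≤s; z≤n)
open import Data.Nat.Properties using (m≤n+m)
open import Data.Fin using (Fin; zero; suc; punchIn; punchOut; _≟_)
open import Data.Fin.Properties using (punchOut-cong; punchIn-punchOut; punchOut-punchIn; punchInᵢ≢i)
open import Data.Bool using (Bool; true; false; not; _∨_; _∧_)
open import Data.Bool.Properties using (∨-zeroʳ)
open import Data.Product using (Σ; _×_; _,_; ∃₂; uncurry)
open import Data.Sum using (_⊎_; inj₁; inj₂)
open import Data.Empty using (⊥; ⊥-elim)
open import Function using (_∘_)
open import Relation.Nullary using (¬_; does; yes; no)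
open import Relation.Nullary.Decidable using (dec-true; dec-false)
open import Relation.Binary.PropositionalEquality using (_≡_; _≢_; refl; sym; trans; cong; subst; subst₂)
open import Relation.Binary.Construct.Closure.ReflexiveTransitive using (Star; ε; _◅_; _◅◅_)

_⊆ᵃ_ : {n : ℕ} → (Fin n → Fin n → Bool) → (Fin n → Fin n → Bool) → Set
R ⊆ᵃ R′ = ∀ u v → R u v ≡ true → R′ u v ≡ true

leaving-arc : {n : ℕ} {R : Fin n → Fin n → Bool} (S : Fin n → Bool) {a b : Fin n} →
              Reach R a b → S a ≡ true → S b ≡ false →
              ∃₂ λ p q → R p q ≡ true × S p ≡ true × S q ≡ false
leaving-arc S ε Sa Sb with () ← trans (sym Sa) Sb
leaving-arc S {a} (_◅_ {j = c} Rac walk) Sa Sb with S c in Sc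
... | true  = leaving-arc S walk Sc Sb
... | false = a , c , Rac , Sa , Sc

Arc : ℕ → Set
Arc n = Fin n × Fin n

record TwoArcCut {n : ℕ} (D : Digraph n) (S : Fin n → Bool) (e f : Arc n) : Set where
  constructor leaving-arcs
  field
    leaving-arc-is : ∀ u v → arc D u v ≡ true → S u ≡ true → S v ≡ false →
                     (u , v) ≡ e ⊎ (u , v) ≡ f
open TwoArcCut

separated-by : {n : ℕ} (S : Fin n → Bool) {a b : Fin n} → S a ≡ true → S b ≡ false → a ≢ b
separated-by S Sa Sb refl with () ← trans (sym Sa) Sb

strong-spanning-meets-cut : {n : ℕ} {D : Digraph n} {S : Fin n → Bool} {e f : Arc n}
  (R : Fin n → Fin n → Bool) → R ⊆ᵃ arc D → StrongArcs R → TwoArcCut D S e f →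
  (a b : Fin n) → S a ≡ true → S b ≡ false → uncurry R e ≡ true ⊎ uncurry R f ≡ true
strong-spanning-meets-cut {S = S} R R⊆D strong cut a b Sa Sb
  with p , q , Rpq , Sp , Sq ← leaving-arc S (strong a b (separated-by S Sa Sb)) Sa Sb
  with leaving-arc-is cut p q (R⊆D p q Rpq) Sp Sq
... | inj₁ refl = inj₁ Rpq
... | inj₂ refl = inj₂ Rpq

exactly-one : ∀ {a b a′ b′} → a ≡ true ⊎ b ≡ true → a′ ≡ true ⊎ b′ ≡ true →
              (a ∧ a′) ≡ false → (b ∧ b′) ≡ false → a ≡ not b
exactly-one {true}  {false} _ _ _ _ = refl
exactly-one {false} {true}  _ _ _ _ = refl
exactly-one {false} {false} (inj₁ ()) _ _ _
exactly-one {false} {false} (inj₂ ()) _ _ _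
exactly-one {true}  {true}  {true}  _ _ () _
exactly-one {true}  {true}  {false} {true} _ _ _ ()
exactly-one {true}  {true}  {false} {false} _ (inj₁ ()) _ _
exactly-one {true}  {true}  {false} {false} _ (inj₂ ()) _ _

decomposition-separates-cut : {n : ℕ} {D : Digraph n} {S : Fin n → Bool} {e f : Arc n} →
  ((A₁ , _) : HasStrongArcDecomposition D) → TwoArcCut D S e f →
  (a b : Fin n) → S a ≡ true → S b ≡ false → uncurry A₁ e ≡ not (uncurry A₁ f)
decomposition-separates-cut {D = D} {e = e} {f}
  (A₁ , A₂ , cover , disjoint , strong₁ , strong₂) cut a b Sa Sb =
  exactly-one (strong-spanning-meets-cut A₁ A₁⊆D strong₁ cut a b Sa Sb)
              (strong-spanning-meets-cut A₂ A₂⊆D strong₂ cut a b Sa Sb)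
              (uncurry disjoint e) (uncurry disjoint f)
  where
  A₁⊆D : A₁ ⊆ᵃ arc D
  A₁⊆D u v A₁uv = trans (sym (cover u v)) (cong (_∨ A₂ u v) A₁uv)
  A₂⊆D : A₂ ⊆ᵃ arc D
  A₂⊆D u v A₂uv = trans (sym (cover u v)) (trans (cong (A₁ u v ∨_) A₂uv) (∨-zeroʳ (A₁ u v)))

no-alternating-five-cycle : ∀ a b c d e → a ≡ not b → b ≡ not c → c ≡ not d → d ≡ not e → e ≡ not a → ⊥
no-alternating-five-cycle _ _ _ _ true  refl refl refl refl ()
no-alternating-five-cycle _ _ _ _ false refl refl refl refl ()

AvoidingWalk : {m : ℕ} → Digraph (ℕ.suc m) → Fin (ℕ.suc m) → Fin (ℕ.suc m) → Fin (ℕ.suc m) → Set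
AvoidingWalk D v = Star (λ p q → arc D p q ≡ true × v ≢ q)

module _ {m : ℕ} (D : Digraph (ℕ.suc m)) (v : Fin (ℕ.suc m)) where

  reach-in-deletion : ∀ {a b} (v≢a : v ≢ a) (v≢b : v ≢ b) → AvoidingWalk D v a b →
                      Reach (arc (deleteVertex D v)) (punchOut v≢a) (punchOut v≢b)
  reach-in-deletion v≢a v≢b ε = subst (Reach _ (punchOut v≢a)) (punchOut-cong v refl) ε
  reach-in-deletion v≢a v≢b ((Dac , v≢c) ◅ walk) = Dac′ ◅ reach-in-deletion v≢c v≢b walk
    where
    Dac′ : arc D (punchIn v (punchOut v≢a)) (punchIn v (punchOut v≢c)) ≡ true
    Dac′ rewrite punchIn-punchOut v≢a | punchIn-punchOut v≢c = Dac

  deletion-strong-via-hub : (h : Fin (ℕ.suc m)) →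
    (∀ a → v ≢ a → AvoidingWalk D v a h) → (∀ b → v ≢ b → AvoidingWalk D v h b) →
    Strong (deleteVertex D v)
  deletion-strong-via-hub h to-hub from-hub i j _ =
    subst₂ (Reach _) (punchOut-punchIn v) (punchOut-punchIn v)
      (reach-in-deletion v≢i v≢j (to-hub _ v≢i ◅◅ from-hub _ v≢j))
    where
    v≢i = punchInᵢ≢i v i ∘ sym
    v≢j = punchInᵢ≢i v j ∘ sym

pattern t₁ = zero
pattern t₂ = suc zero
pattern y  = suc (suc zero)
pattern inC c = suc (suc (suc c))
pattern x  = inC zero
pattern z  = inC (suc zero)

arcᴰ : {k : ℕ} → Fin (5 + k) → Fin (5 + k) → Bool
arcᴰ t₁ t₂ = true
arcᴰ t₁ (inC _) = true
arcᴰ t₂ y = true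
arcᴰ t₂ (inC _) = true
arcᴰ y t₁ = true
arcᴰ y t₂ = true
-- Placed before the x and z clauses so that arcᴰ (inC c) (inC d) computes for variable c.
arcᴰ (inC c) (inC d) = not (does (c ≟ d))
arcᴰ x t₁ = true
arcᴰ z y = true
arcᴰ _ _ = false

arcᴰ-loopless : {k : ℕ} (u : Fin (5 + k)) → arcᴰ u u ≡ false
arcᴰ-loopless t₁ = refl
arcᴰ-loopless t₂ = refl
arcᴰ-loopless y = refl
arcᴰ-loopless (inC c) = cong not (dec-true (c ≟ c) refl)

counterexample : (k : ℕ) → Digraph (5 + k)
counterexample k = record { arc = arcᴰ ; loopless = arcᴰ-loopless }

isY : {k : ℕ} → Fin (5 + k) → Bool
isY y = true
isY _ = false

isY-independent : {k : ℕ} (u v : Fin (5 + k)) → isY u ≡ true → isY v ≡ true → arcᴰ u v ≡ false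
isY-independent y y _ _ = refl

non-isY-semicomplete : {k : ℕ} (u v : Fin (5 + k)) → isY u ≡ false → isY v ≡ false → u ≢ v →
                       arcᴰ u v ≡ true ⊎ arcᴰ v u ≡ true
non-isY-semicomplete t₁ t₁ _ _ u≢v = ⊥-elim (u≢v refl)
non-isY-semicomplete t₁ t₂ _ _ _ = inj₁ refl
non-isY-semicomplete t₁ (inC _) _ _ _ = inj₁ refl
non-isY-semicomplete t₂ t₁ _ _ _ = inj₂ refl
non-isY-semicomplete t₂ t₂ _ _ u≢v = ⊥-elim (u≢v refl)
non-isY-semicomplete t₂ (inC _) _ _ _ = inj₁ refl
non-isY-semicomplete (inC _) t₁ _ _ _ = inj₂ refl
non-isY-semicomplete (inC _) t₂ _ _ _ = inj₂ refl
non-isY-semicomplete (inC c) (inC d) _ _ u≢v = inj₁ (cong not (dec-false (c ≟ d) (u≢v ∘ cong inC)))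

counterexample-split : {k : ℕ} → Split (counterexample k)
counterexample-split = isY , (y , refl) , (t₁ , refl) , isY-independent , non-isY-semicomplete

module _ {k : ℕ} where

  Walk : Fin (5 + k) → Fin (5 + k) → Fin (5 + k) → Set
  Walk = AvoidingWalk (counterexample k)

  _⟶⟨_⟩_ : ∀ {v b c} (a : Fin (5 + k)) → arcᴰ a b ≡ true × v ≢ b → Walk v b c → Walk v a c
  a ⟶⟨ step ⟩ walk = step ◅ walk

  infixr 5 _⟶⟨_⟩_

  to-x : ∀ v → v ≢ x → ∀ a → v ≢ a → Walk v a x
  to-x v v≢x t₁ _ = t₁ ⟶⟨ refl , v≢x ⟩ ε
  to-x v v≢x t₂ _ = t₂ ⟶⟨ refl , v≢x ⟩ ε
  to-x t₁ v≢x y _ = y ⟶⟨ refl , (λ ()) ⟩ t₂ ⟶⟨ refl , v≢x ⟩ ε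
  to-x (suc v) v≢x y _ = y ⟶⟨ refl , (λ ()) ⟩ t₁ ⟶⟨ refl , v≢x ⟩ ε
  to-x v v≢x x _ = ε
  to-x v v≢x (inC (suc c)) _ = inC (suc c) ⟶⟨ refl , v≢x ⟩ ε

  from-x : ∀ v → v ≢ x → ∀ b → v ≢ b → Walk v x b
  from-x v _ t₁ v≢b = x ⟶⟨ refl , v≢b ⟩ ε
  from-x t₁ _ t₂ v≢b = x ⟶⟨ refl , (λ ()) ⟩ z ⟶⟨ refl , (λ ()) ⟩ y ⟶⟨ refl , v≢b ⟩ ε
  from-x (suc v) _ t₂ v≢b = x ⟶⟨ refl , (λ ()) ⟩ t₁ ⟶⟨ refl , v≢b ⟩ ε
  from-x z _ y v≢b = x ⟶⟨ refl , (λ ()) ⟩ t₁ ⟶⟨ refl , (λ ()) ⟩ t₂ ⟶⟨ refl , v≢b ⟩ ε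
  from-x t₁ _ y v≢b = x ⟶⟨ refl , (λ ()) ⟩ z ⟶⟨ refl , v≢b ⟩ ε
  from-x t₂ _ y v≢b = x ⟶⟨ refl , (λ ()) ⟩ z ⟶⟨ refl , v≢b ⟩ ε
  from-x y _ y v≢b = ⊥-elim (v≢b refl)
  from-x x v≢x y _ = ⊥-elim (v≢x refl)
  from-x (inC (suc (suc c))) _ y v≢b = x ⟶⟨ refl , (λ ()) ⟩ z ⟶⟨ refl , v≢b ⟩ ε
  from-x v _ x _ = ε
  from-x v _ (inC (suc c)) v≢b = x ⟶⟨ refl , v≢b ⟩ ε

  to-z : ∀ a → x ≢ a → Walk x a z
  to-z t₁ _ = t₁ ⟶⟨ refl , (λ ()) ⟩ ε
  to-z t₂ _ = t₂ ⟶⟨ refl , (λ ()) ⟩ ε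
  to-z y _ = y ⟶⟨ refl , (λ ()) ⟩ t₁ ⟶⟨ refl , (λ ()) ⟩ ε
  to-z x x≢a = ⊥-elim (x≢a refl)
  to-z z _ = ε
  to-z (inC (suc (suc c))) _ = inC (suc (suc c)) ⟶⟨ refl , (λ ()) ⟩ ε

  from-z : ∀ b → x ≢ b → Walk x z b
  from-z t₁ _ = z ⟶⟨ refl , (λ ()) ⟩ y ⟶⟨ refl , (λ ()) ⟩ ε
  from-z t₂ _ = z ⟶⟨ refl , (λ ()) ⟩ y ⟶⟨ refl , (λ ()) ⟩ ε
  from-z y _ = z ⟶⟨ refl , (λ ()) ⟩ ε
  from-z x x≢b = ⊥-elim (x≢b refl)
  from-z z _ = ε
  from-z (inC (suc (suc c))) x≢b = z ⟶⟨ refl , x≢b ⟩ ε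

  counterexample-two-strong : TwoStrong (counterexample k)
  counterexample-two-strong = s≤s (s≤s (s≤s z≤n)) , deletion-strong
    where
    deletion-strong : ∀ v → Strong (deleteVertex (counterexample k) v)
    deletion-strong v with v ≟ x
    ... | yes refl = deletion-strong-via-hub (counterexample k) x z to-z from-z
    ... | no v≢x   = deletion-strong-via-hub (counterexample k) v x (to-x v v≢x) (from-x v v≢x)

  ¬t₁ ¬t₂ ¬t₂¬y isC : Fin (5 + k) → Bool
  ¬t₁ t₁ = false
  ¬t₁ _  = true
  ¬t₂ t₂ = false
  ¬t₂ _  = true
  ¬t₂¬y t₂ = false
  ¬t₂¬y y  = false
  ¬t₂¬y _  = true
  isC (inC _) = true
  isC _       = false

  cut-¬t₁ : TwoArcCut (counterexample k) ¬t₁ (x , t₁) (y , t₁)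
  cut-¬t₁ = leaving-arcs λ where
    x t₁ _ _ _ → inj₁ refl
    y t₁ _ _ _ → inj₂ refl

  cut-isY : TwoArcCut (counterexample k) isY (y , t₁) (y , t₂)
  cut-isY = leaving-arcs λ where
    y t₁ _ _ _ → inj₁ refl
    y t₂ _ _ _ → inj₂ refl

  cut-¬t₂ : TwoArcCut (counterexample k) ¬t₂ (y , t₂) (t₁ , t₂)
  cut-¬t₂ = leaving-arcs λ where
    y t₂ _ _ _ → inj₁ refl
    t₁ t₂ _ _ _ → inj₂ refl

  cut-¬t₂¬y : TwoArcCut (counterexample k) ¬t₂¬y (t₁ , t₂) (z , y)
  cut-¬t₂¬y = leaving-arcs λ where
    t₁ t₂ _ _ _ → inj₁ refl
    z y _ _ _ → inj₂ refl
    t₁ y () _ _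
    t₁ (inC _) _ _ ()

  cut-isC : TwoArcCut (counterexample k) isC (z , y) (x , t₁)
  cut-isC = leaving-arcs λ where
    z y _ _ _ → inj₁ refl
    x t₁ _ _ _ → inj₂ refl
    x t₂ () _ _
    x y () _ _
    x (inC _) _ _ ()

  counterexample-no-strong-arc-decomposition : ¬ HasStrongArcDecomposition (counterexample k)
  counterexample-no-strong-arc-decomposition dec@(A₁ , _) =
    no-alternating-five-cycle (A₁ x t₁) (A₁ y t₁) (A₁ y t₂) (A₁ t₁ t₂) (A₁ z y)
      (decomposition-separates-cut dec cut-¬t₁   t₂ t₁ refl refl)
      (decomposition-separates-cut dec cut-isY   y  t₁ refl refl)
      (decomposition-separates-cut dec cut-¬t₂   t₁ t₂ refl refl)
      (decomposition-separates-cut dec cut-¬t₂¬y t₁ t₂ refl refl)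
      (decomposition-separates-cut dec cut-isC   x  t₁ refl refl)

corollary4p10 : ∀ (N : ℕ) → Σ ℕ λ n → N ≤ n × Σ (Digraph n) λ D →
    TwoStrong D × Split D × ¬ HasStrongArcDecomposition D
corollary4p10 N =
  5 + N , m≤n+m N 5 , counterexample N ,
  counterexample-two-strong , counterexample-split , counterexample-no-strong-arc-decomposition
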